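{- Let $\Delta$ be a finite set of quantifier-free insertion queries for the edge relation $E$. Then $(q_{\text{Reach}},\Delta\cup\Delta_{E})$ can be maintained in $\mathrm{DynFO}$ for directed acyclic graphs. Furthermore, for each quantifier-free insertion query in $\Delta$ there is a first-order guard formula which checks (on the current state of the dynamic program) whether the corresponding insertion destroys the acyclicity of the graph.
   Context: Databases: a schema consists of relation symbols (with arities) and constant symbols; a database over a schema with a finite domain $D$ interprets them over $D$. A replacement rule for a relation symbol $R$ is a pair $R := \mu_R(\bar p;\bar x)$, where $\mu_R$ is a first-order formula over the schema, $\bar x$ has the arity of $R$, and $\bar p$ is a tuple of parameter variables. A replacement query $\rho(\bar p)$ is a set of replacement rules for distinct relation symbols with the same parameters. A change $\delta=\rho(\bar a)$ ($\bar a$ a tuple of domain elements) maps a database $\mathcal D$ to $\delta(\mathcal D)$, obtained by replacing each $R$ having a rule by $\{\bar b\mid\mathcal D\models\mu_R(\bar a;\bar b)\}$. An insertion query has all replacement formulas of the form $R(\bar x)\lor\varphi_R(\bar p,\bar x)$; it is quantifier-free if the $\varphi_R$ are quantifier-free. Single-tuple changes are $\mathrm{insert}_R(\bar p)$ with $\mu_R=R(\bar x)\lor\bar x=\bar p$ and $\mathrm{delete}_R(\bar p)$ with $\mu_R=R(\bar x)\land\neg(\bar x=\bar p)$; for graphs (structures with one binary relation $E$) $\Delta_E$ is the set of these two queries for $E$. Dynamic programs: states $(D,\mathcal I,\mathcal A)$ consist of an input database and an auxiliary database over the same fixed finite domain. For each allowed replacement query $\rho(\bar p)$ and each auxiliary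 relation $T$ there is an update formula $\varphi^\rho_T(\bar p;\bar x)$ over input and auxiliary schema; after a change $\rho(\bar a)$ the input becomes $\delta(\mathcal I)$ and $T$ becomes $\{\bar b\mid(\mathcal I,\mathcal A)\models\varphi^\rho_T(\bar a;\bar b)\}$ (evaluated in the old state). A program maintains $(q,\Delta)$ ($q$ $k$-ary) if a designated $k$-ary auxiliary relation $Q$ equals $q$ of the current input after every non-empty change sequence from $\Delta$ applied to the empty input and empty auxiliary database. $\mathrm{DynFO}$: dynamic queries maintainable with first-order update formulas. For directed acyclic graphs, only change sequences are considered in which every graph obtained stays acyclic. $q_{\text{Reach}}$ maps a graph to the set of pairs $(u,v)$ such that there is a directed path from $u$ to $v$. -}

module Defs where

open import Data.Nat using (ℕ; zero; suc; _+_)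
open import Data.Fin using (Fin; zero; suc; _↑ʳ_)
open import Data.Vec using (Vec; []; _∷_; _++_; lookup)
open import Data.List as List using (List; []; _∷_; foldl; length; map)
open import Data.List.Relation.Unary.All using (All)
import Data.Bool.ListAction
open import Data.Bool using (Bool; true; false; not; _∧_; _∨_)
open import Data.Unit using (⊤; tt)
open import Data.Sum using (_⊎_; inj₁; inj₂)
open import Data.Product using (Σ; _×_; _,_; ∃)
open import Relation.Binary.PropositionalEquality using (_≡_)
open import Relation.Nullary using (¬_)
open import Function.Bundles using (_⇔_)

record Sig : Set₁ where
  field
    Sym : Set
    ar  : Sym → ℕ
open Sig public

-- Structures over the finite domain Fin n; relations are Boolean-valued
-- predicates on tuples (the domain is finite, so this is exact).
Structure : Sig → ℕ → Set
Structure σ n = (r : Sym σ) → Vec (Fin n) (ar σ r) → Bool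

-- First-order formulas with v free variables (de Bruijn; a quantifier
-- binds variable zero and shifts the others by suc).
data Formula (σ : Sig) (v : ℕ) : Set where
  rel  : (r : Sym σ) → Vec (Fin v) (ar σ r) → Formula σ v
  _≐_  : Fin v → Fin v → Formula σ v
  ⊤f   : Formula σ v
  ⊥f   : Formula σ v
  ¬f_  : Formula σ v → Formula σ v
  _∧f_ : Formula σ v → Formula σ v → Formula σ v
  _∨f_ : Formula σ v → Formula σ v → Formula σ v
  ∃f   : Formula σ (suc v) → Formula σ v
  ∀f   : Formula σ (suc v) → Formula σ v

data QF {σ : Sig} {v : ℕ} : Formula σ v → Set where
  qf-rel : ∀ r xs → QF (rel r xs)
  qf-eq  : ∀ x y → QF (x ≐ y)
  qf-⊤   : QF ⊤f
  qf-⊥   : QF ⊥f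
  qf-¬   : ∀ {φ} → QF φ → QF (¬f φ)
  qf-∧   : ∀ {φ ψ} → QF φ → QF ψ → QF (φ ∧f ψ)
  qf-∨   : ∀ {φ ψ} → QF φ → QF ψ → QF (φ ∨f ψ)

_▸_ : ∀ {v n} → Fin n → (Fin v → Fin n) → (Fin (suc v) → Fin n)
(a ▸ ρ) zero    = a
(a ▸ ρ) (suc i) = ρ i

eqFin : ∀ {n} → Fin n → Fin n → Bool
eqFin zero    zero    = true
eqFin zero    (suc _) = false
eqFin (suc _) zero    = false
eqFin (suc i) (suc j) = eqFin i j

eval : ∀ {σ v n} → Structure σ n → Formula σ v → (Fin v → Fin n) → Bool
eval S (rel r xs) ρ = S r (Data.Vec.map ρ xs)
eval S (x ≐ y)    ρ = eqFin (ρ x) (ρ y)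
eval S ⊤f         ρ = true
eval S ⊥f         ρ = false
eval S (¬f φ)     ρ = not (eval S φ ρ)
eval S (φ ∧f ψ)   ρ = eval S φ ρ ∧ eval S ψ ρ
eval S (φ ∨f ψ)   ρ = eval S φ ρ ∨ eval S ψ ρ
eval {n = n} S (∃f φ) ρ = Data.Bool.ListAction.any (λ a → eval S φ (a ▸ ρ)) (List.allFin n)
eval {n = n} S (∀f φ) ρ = Data.Bool.ListAction.all (λ a → eval S φ (a ▸ ρ)) (List.allFin n)

env : ∀ {n p k} → Vec (Fin n) p → Vec (Fin n) k → Fin (p + k) → Fin n
env ā b̄ i = lookup (ā ++ b̄) i

graphSig : Sig
graphSig = record { Sym = ⊤ ; ar = λ _ → 2 }

Graph : ℕ → Set
Graph n = Structure graphSig n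

Edge : ∀ {n} → Graph n → Fin n → Fin n → Set
Edge G u v = G tt (u ∷ v ∷ []) ≡ true

data Path {n} (G : Graph n) : Fin n → Fin n → Set where
  here  : ∀ {u} → Path G u u
  there : ∀ {u w v} → Edge G u w → Path G w v → Path G u v

Reach : ∀ {n} → Graph n → Fin n → Fin n → Set
Reach G u v = Path G u v

HasCycle : ∀ {n} → Graph n → Set
HasCycle {n} G = Σ (Fin n) λ u → Σ (Fin n) λ w → Edge G u w × Path G w u

Acyclic : ∀ {n} → Graph n → Set
Acyclic G = ¬ HasCycle G

-- Replacement queries for E (parameters are variables 0..p-1,
-- x̄ = (x , y) are variables p , p+1)

record ChangeQuery : Set where
  field
    params : ℕ
    μ      : Formula graphSig (params + 2)
open ChangeQuery public

applyChange : ∀ {n} (c : ChangeQuery) → Vec (Fin n) (params c) → Graph n → Graph n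
applyChange c ā G tt b̄ = eval G (μ c) (env ā b̄)

-- quantifier-free insertion query: E(x̄) ∨ φ(p̄, x̄) with φ quantifier-free
record InsertionQuery : Set where
  field
    p    : ℕ
    φ    : Formula graphSig (p + 2)
    φ-qf : QF φ
open InsertionQuery public

insToChange : InsertionQuery → ChangeQuery
insToChange q = record
  { params = p q
  ; μ = rel tt ((p q ↑ʳ zero) ∷ (p q ↑ʳ suc zero) ∷ []) ∨f φ q }

-- Δ_E : single-edge insertion and deletion (parameters 0,1; x̄ = 2,3)
insertE : ChangeQuery
insertE = record { params = 2 ; μ =
  rel tt (suc (suc zero) ∷ suc (suc (suc zero)) ∷ [])
  ∨f ((suc (suc zero) ≐ zero) ∧f (suc (suc (suc zero)) ≐ suc zero)) }

deleteE : ChangeQuery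
deleteE = record { params = 2 ; μ =
  rel tt (suc (suc zero) ∷ suc (suc (suc zero)) ∷ [])
  ∧f (¬f ((suc (suc zero) ≐ zero) ∧f (suc (suc (suc zero)) ≐ suc zero))) }

allowed : List InsertionQuery → List ChangeQuery
allowed Δ = map insToChange Δ List.++ (insertE ∷ deleteE ∷ [])

-- Dynamic programs (relational auxiliary schema; auxiliary symbol
-- zero is the designated binary query relation Q)

auxAr' : ∀ {k} → (Fin k → ℕ) → Fin (suc k) → ℕ
auxAr' as zero    = 2
auxAr' as (suc i) = as i

auxSig' : ∀ k → (Fin k → ℕ) → Sig
auxSig' k as = record { Sym = Fin (suc k) ; ar = auxAr' as }

stateSig' : ∀ k → (Fin k → ℕ) → Sig
stateSig' k as = record { Sym = ⊤ ⊎ Fin (suc k)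
                        ; ar = λ { (inj₁ _) → 2 ; (inj₂ T) → auxAr' as T } }

record Program (L : List ChangeQuery) : Set where
  field
    k       : ℕ
    arities : Fin k → ℕ
    update  : (i : Fin (length L)) (T : Fin (suc k))
            → Formula (stateSig' k arities) (params (List.lookup L i) + auxAr' arities T)
open Program public

auxSig : ∀ {L} → Program L → Sig
auxSig P = auxSig' (k P) (arities P)

stateSig : ∀ {L} → Program L → Sig
stateSig P = stateSig' (k P) (arities P)

record State {L} (P : Program L) (n : ℕ) : Set where
  constructor ⟨_,_⟩
  field
    input : Graph n
    aux   : Structure (auxSig P) n
open State public

asStructure : ∀ {L} {P : Program L} {n} → State P n → Structure (stateSig P) n
asStructure s (inj₁ tt) = input s tt
asStructure s (inj₂ T)  = aux s T

Change : ℕ → List ChangeQuery → Set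
Change n L = Σ (Fin (length L)) λ i → Vec (Fin n) (params (List.lookup L i))

initState : ∀ {L} (P : Program L) n → State P n
initState P n = ⟨ (λ _ _ → false) , (λ _ _ → false) ⟩

step : ∀ {L} (P : Program L) {n} → State P n → Change n L → State P n
step {L} P s (i , ā) =
  ⟨ applyChange (List.lookup L i) ā (input s)
  , (λ T b̄ → eval (asStructure s) (update P i T) (env ā b̄)) ⟩

run : ∀ {L} (P : Program L) {n} → List (Change n L) → State P n
run P {n} cs = foldl (step P) (initState P n) cs

-- states after each non-empty prefix of a change sequence
trace : ∀ {L} (P : Program L) {n} → State P n → List (Change n L) → List (State P n)
trace P s []       = []
trace P s (c ∷ cs) = step P s c ∷ trace P (step P s c) cs

ValidSeq : ∀ {L} (P : Program L) {n} → List (Change n L) → Set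
ValidSeq P {n} cs = All (λ s → Acyclic (input s)) (trace P (initState P n) cs)

MaintainsReachDAG : ∀ {L} → Program L → Set
MaintainsReachDAG {L} P = ∀ n (cs : List (Change n L)) → ¬ (cs ≡ []) → ValidSeq P cs →
  ∀ u v → (aux (run P cs) zero (u ∷ v ∷ []) ≡ true) ⇔ Reach (input (run P cs)) u v

IsGuard : ∀ {L} (P : Program L) (q : InsertionQuery) → Formula (stateSig P) (p q) → Set
IsGuard {L} P q γ = ∀ n (cs : List (Change n L)) → ValidSeq P cs →
  ∀ (ā : Vec (Fin n) (p q)) →
  (eval (asStructure (run P cs)) γ (λ i → lookup ā i) ≡ true)
    ⇔ HasCycle (applyChange (insToChange q) ā (input (run P cs)))

module Submission where

-- The program keeps one auxiliary relation Q, which after every change is the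
-- (reflexive) reachability relation; the initial empty Q represents it up to
-- the diagonal, so all update formulas read "Q(u,v) ∨ u = v".
--
-- A query q(ā) adds the edges x → y with Φ(x,y) = φ(ā,x,y).  The
-- type of a vertex x collects the atomic facts relating x to ā.  As φ is
-- quantifier-free, Φ(u,y) = Φ(x,y) whenever u and x have the same type and look
-- alike from y.  Hence every path of the new graph either closes a cycle or can
-- be normalised so that its genuinely new edges start at vertices of pairwise
-- distinct types (a later new edge of the same source type can be taken
-- already at the earlier vertex).  So if the new graph is acyclic, reachability
-- in it needs at most N new edges, N the number of types, which depends on |ā|
-- only, and is first-order definable from the old Q.  The same normal form
-- gives the guard: the new graph has a cycle iff some new-graph edge x → y is
-- followed by such a bounded path from y back to x.
--
-- Deletions use the classical update for acyclic graphs: after deleting a → b,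
-- x still reaches y iff no old path from x to y uses a → b, or some remaining
-- edge u → v on the way leaves the set of vertices reaching a.

open import Defs
open import Data.Nat using (ℕ; zero; suc; _+_; _*_; _≤_; z≤n; s≤s)
open import Data.Nat.Properties using (≤-trans; ≤-reflexive; +-suc; +-identityʳ)
open import Data.Fin using (Fin; zero; suc; _↑ʳ_; _↑ˡ_; _≟_)
open import Data.Vec as Vec using (Vec; []; _∷_; _++_; lookup; tabulate)
open import Data.Vec.Properties
  using ( ∷-injectiveˡ; lookup-++ˡ; lookup-++ʳ; lookup-map; map-++; map-∘; map-cong
        ; tabulate-∘; tabulate-cong; tabulate∘lookup; ≡-dec)
import Data.Vec.Relation.Unary.All as VecAll
open import Data.List as List using (List; []; _∷_; [_]; length; foldl; allFin)
open import Data.List.Properties using (length-++-sucʳ; ++-assoc)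
open import Data.List.Relation.Unary.All as All using (All; []; _∷_)
open import Data.List.Relation.Unary.All.Properties using (++⁻ˡ; ¬Any⇒All¬)
open import Data.List.Relation.Unary.AllPairs using ([]; _∷_)
open import Data.List.Relation.Unary.Any using (here; there)
open import Data.List.Relation.Unary.Any.Properties using (any⁺; any⁻)
open import Data.List.Relation.Unary.Unique.Propositional using (Unique)
open import Data.List.Membership.Propositional using (_∈_; find; lose)
open import Data.List.Membership.Propositional.Properties
  using (∈-allFin; ∈-∃++; ∈-++⁻; ∈-++⁺ˡ; ∈-++⁺ʳ; ∈-map⁺)
import Data.List.Membership.DecPropositional as DecMembership
open import Data.Bool as Bool using (Bool; true; false; not; _∧_; _∨_)
open import Data.Bool.Properties using (T-≡)
open import Data.Bool.ListAction using (any)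
open import Data.Unit using (tt)
open import Data.Sum as Sum using (_⊎_; inj₁; inj₂)
open import Data.Product using (∃; ∃₂; _×_; _,_; proj₁; proj₂; uncurry)
open import Data.Empty using (⊥-elim)
open import Function using (_∘_; id)
open import Function.Bundles using (_⇔_; mk⇔; Equivalence)
open import Function.Construct.Composition using (_⇔-∘_)
open import Relation.Binary.PropositionalEquality
  using (_≡_; _≢_; refl; sym; trans; cong; cong₂; subst; subst₂; module ≡-Reasoning)
open import Relation.Nullary using (¬_; Dec; yes; no; contradiction)
open import Relation.Nullary.Decidable using (_×-dec_)

open Equivalence using (to; from)

-- Satisfaction of Boolean connectives, stated as congruences of ⇔ so that the
-- meaning of a formula can be computed compositionally.

false≢true : false ≢ true
false≢true ()

∧-sat : ∀ {a b} {P Q : Set} → (a ≡ true ⇔ P) → (b ≡ true ⇔ Q) → (a ∧ b ≡ true) ⇔ (P × Q)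
∧-sat {true}  hp hq = mk⇔ (λ e → to hp refl , to hq e) (from hq ∘ proj₂)
∧-sat {false} hp hq = mk⇔ (λ ()) (from hp ∘ proj₁)

∨-sat : ∀ {a b} {P Q : Set} → (a ≡ true ⇔ P) → (b ≡ true ⇔ Q) → (a ∨ b ≡ true) ⇔ (P ⊎ Q)
∨-sat {true}  hp hq = mk⇔ (λ _ → inj₁ (to hp refl)) (λ _ → refl)
∨-sat {false} hp hq = mk⇔ (inj₂ ∘ to hq) Sum.[ (λ p → contradiction (from hp p) false≢true) , from hq ]

not-sat : ∀ {a} {P : Set} → (a ≡ true ⇔ P) → (not a ≡ true) ⇔ (¬ P)
not-sat {true}  hp = mk⇔ (λ ()) (λ ¬p → contradiction (to hp refl) ¬p)
not-sat {false} hp = mk⇔ (λ _ p → false≢true (from hp p)) (λ _ → refl)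

∃-sat : ∀ {n} {f : Fin n → Bool} {P : Fin n → Set} →
  (∀ a → f a ≡ true ⇔ P a) → (any f (allFin n) ≡ true) ⇔ ∃ P
∃-sat {n} {f} hp = mk⇔ witness (λ (a , pa) → to T-≡ (any⁺ f (lose (∈-allFin a) (from T-≡ (from (hp a) pa)))))
  where
  witness : any f (allFin n) ≡ true → ∃ _
  witness e with a , _ , fa ← find (any⁻ f (allFin n) (from T-≡ e)) = a , to (hp a) (to T-≡ fa)

≡-sat : ∀ {a b} → a ≡ b → (a ≡ true) ⇔ (b ≡ true)
≡-sat e = mk⇔ (trans (sym e)) (trans e)

eqFin-sat : ∀ {n} {x y : Fin n} → (eqFin x y ≡ true) ⇔ (x ≡ y)
eqFin-sat = mk⇔ sound complete
  where
  sound : ∀ {n} {x y : Fin n} → eqFin x y ≡ true → x ≡ y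
  sound {x = zero}  {zero}  _ = refl
  sound {x = zero}  {suc _} ()
  sound {x = suc _} {zero}  ()
  sound {x = suc x} {suc y} e = cong suc (sound e)
  complete : ∀ {n} {x y : Fin n} → x ≡ y → eqFin x y ≡ true
  complete {x = zero}  refl = refl
  complete {x = suc x} refl = complete {x = x} refl

-- The equality test is symmetric (types record both orders of each test).
eqFin-sym : ∀ {n} (x y : Fin n) → eqFin x y ≡ eqFin y x
eqFin-sym zero    zero    = refl
eqFin-sym zero    (suc _) = refl
eqFin-sym (suc _) zero    = refl
eqFin-sym (suc x) (suc y) = eqFin-sym x y

_++ₚ_ : ∀ {n} {G : Graph n} {u w v} → Path G u w → Path G w v → Path G u v
here       ++ₚ q = q
there e p ++ₚ q = there e (p ++ₚ q)

mapPath : ∀ {n} {G H : Graph n} → (∀ {x y} → Edge G x y → Edge H x y) → ∀ {u v} → Path G u v → Path H u v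
mapPath f here        = here
mapPath f (there e p) = there (f e) (mapPath f p)

≡⇒Path : ∀ {n} {G : Graph n} {u v} → u ≡ v → Path G u v
≡⇒Path refl = here

edge⇒Path : ∀ {n} {G : Graph n} {u v} → Edge G u v → Path G u v
edge⇒Path e = there e here

qf-invariant : ∀ {σ v n} (S : Structure σ n) {φ : Formula σ v} → QF φ → (ρ ρ' : Fin v → Fin n) →
  (∀ i j → eqFin (ρ i) (ρ j) ≡ eqFin (ρ' i) (ρ' j)) →
  (∀ r xs → S r (Vec.map ρ xs) ≡ S r (Vec.map ρ' xs)) →
  eval S φ ρ ≡ eval S φ ρ'
qf-invariant S (qf-rel r xs) ρ ρ' eqs atoms = atoms r xs
qf-invariant S (qf-eq x y)   ρ ρ' eqs atoms = eqs x y
qf-invariant S qf-⊤          ρ ρ' eqs atoms = refl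
qf-invariant S qf-⊥          ρ ρ' eqs atoms = refl
qf-invariant S (qf-¬ q)      ρ ρ' eqs atoms = cong not (qf-invariant S q ρ ρ' eqs atoms)
qf-invariant S (qf-∧ q r)    ρ ρ' eqs atoms =
  cong₂ _∧_ (qf-invariant S q ρ ρ' eqs atoms) (qf-invariant S r ρ ρ' eqs atoms)
qf-invariant S (qf-∨ q r)    ρ ρ' eqs atoms =
  cong₂ _∨_ (qf-invariant S q ρ ρ' eqs atoms) (qf-invariant S r ρ ρ' eqs atoms)

qf-cong : ∀ {σ v n} (S : Structure σ n) {φ : Formula σ v} → QF φ → {ρ ρ' : Fin v → Fin n} →
  (∀ i → ρ i ≡ ρ' i) → eval S φ ρ ≡ eval S φ ρ'
qf-cong S q {ρ} {ρ'} h =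
  qf-invariant S q ρ ρ' (λ i j → cong₂ eqFin (h i) (h j)) (λ r xs → cong (S r) (map-cong h xs))

env-fst : ∀ {n m} (ā : Vec (Fin n) m) u v → env ā (u ∷ v ∷ []) (m ↑ʳ zero) ≡ u
env-fst ā u v = lookup-++ʳ ā (u ∷ v ∷ []) zero

env-snd : ∀ {n m} (ā : Vec (Fin n) m) u v → env ā (u ∷ v ∷ []) (m ↑ʳ suc zero) ≡ v
env-snd ā u v = lookup-++ʳ ā (u ∷ v ∷ []) (suc zero)

map-tabulate-lookup : ∀ {A B : Set} {m} (ā : Vec A m) (f : Fin m → B) (ρ : B → A) →
  (∀ i → ρ (f i) ≡ lookup ā i) → Vec.map ρ (tabulate f) ≡ ā
map-tabulate-lookup ā f ρ h = begin
  Vec.map ρ (tabulate f)  ≡⟨ tabulate-∘ ρ f ⟨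
  tabulate (ρ ∘ f)        ≡⟨ tabulate-cong h ⟩
  tabulate (lookup ā)     ≡⟨ tabulate∘lookup ā ⟩
  ā                       ∎
  where open ≡-Reasoning

unique-prefix : ∀ {A : Set} (xs : List A) {ys} → Unique (xs List.++ ys) → Unique xs
unique-prefix []       _          = []
unique-prefix (x ∷ xs) (px ∷ uxs) = ++⁻ˡ xs px ∷ unique-prefix xs uxs

unique-suffix : ∀ {A : Set} (xs : List A) {ys} → Unique (xs List.++ ys) → Unique ys
unique-suffix []       u         = u
unique-suffix (x ∷ xs) (_ ∷ uxs) = unique-suffix xs uxs

unique-length : ∀ {A : Set} {xs ys : List A} → Unique xs → (∀ {z} → z ∈ xs → z ∈ ys) →
  length xs ≤ length ys
unique-length {xs = []}     _             _     = z≤n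
unique-length {xs = x ∷ xs} (x∉xs ∷ uxs) xs⊆ys with ys₁ , ys₂ , refl ← ∈-∃++ (xs⊆ys (here refl)) =
  ≤-trans (s≤s (unique-length uxs (λ z∈xs → remove (xs⊆ys (there z∈xs)) (All.lookup x∉xs z∈xs))))
          (≤-reflexive (sym (length-++-sucʳ ys₁ x ys₂)))
  where
  remove : ∀ {z} → z ∈ ys₁ List.++ x ∷ ys₂ → x ≢ z → z ∈ ys₁ List.++ ys₂
  remove z∈ x≢z with ∈-++⁻ ys₁ z∈
  ... | inj₁ z∈ys₁          = ∈-++⁺ˡ z∈ys₁
  ... | inj₂ (here refl)    = contradiction refl x≢z
  ... | inj₂ (there z∈ys₂) = ∈-++⁺ʳ ys₁ z∈ys₂

allVecs : ∀ c → List (Vec Bool c)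
allVecs zero    = [ [] ]
allVecs (suc c) = List.map (true ∷_) (allVecs c) List.++ List.map (false ∷_) (allVecs c)

∈-allVecs : ∀ {c} (t : Vec Bool c) → t ∈ allVecs c
∈-allVecs []          = here refl
∈-allVecs (true ∷ t)  = ∈-++⁺ˡ (∈-map⁺ (true ∷_) (∈-allVecs t))
∈-allVecs (false ∷ t) = ∈-++⁺ʳ _ (∈-map⁺ (false ∷_) (∈-allVecs t))

-- The type of a vertex relative to k parameters is a Boolean vector of this
-- length.
profileSize : ℕ → ℕ
profileSize k = suc (k * 4)

-- The number of types, which bounds the number of new edges a path needs after
-- an insertion with k parameters.  It is kept opaque so that formulas indexed
-- by it are never unfolded.
opaque
  maxHops : ℕ → ℕ
  maxHops k = length (allVecs (profileSize k))

  unique-types-bound : ∀ {k} {ts : List (Vec Bool (profileSize k))} → Unique ts → length ts ≤ maxHops k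
  unique-types-bound uniq = unique-length uniq (λ _ → ∈-allVecs _)

∷⁴-injective : ∀ {A : Set} {c} {a b d e a' b' d' e' : A} {xs ys : Vec A c} →
  _≡_ {A = Vec A (suc (suc (suc (suc c))))} (a ∷ b ∷ d ∷ e ∷ xs) (a' ∷ b' ∷ d' ∷ e' ∷ ys) →
  a ≡ a' × b ≡ b' × d ≡ d' × e ≡ e' × xs ≡ ys
∷⁴-injective refl = refl , refl , refl , refl , refl

module Insertion {n} (q : InsertionQuery) (G : Graph n) (ā : Vec (Fin n) (p q)) where

  E : Fin n → Fin n → Bool
  E x y = G tt (x ∷ y ∷ [])

  Φ : Fin n → Fin n → Bool
  Φ x y = eval G (φ q) (env ā (x ∷ y ∷ []))

  G⁺ : Graph n
  G⁺ = applyChange (insToChange q) ā G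

  edge⁺-sat : ∀ {x y} → Edge G⁺ x y ⇔ (Edge G x y ⊎ Φ x y ≡ true)
  edge⁺-sat {x} {y} =
    ∨-sat (≡-sat (cong (λ z → G tt z) (cong₂ (λ c d → c ∷ d ∷ []) (env-fst ā x y) (env-snd ā x y))))
          (mk⇔ id id)

  lift⁺ : ∀ {u v} → Path G u v → Path G⁺ u v
  lift⁺ = mapPath (from edge⁺-sat ∘ inj₁)

  profile : ∀ {k} → Vec (Fin n) k → Fin n → Vec Bool (profileSize k)
  profile []       x = E x x ∷ []
  profile (c ∷ cs) x = eqFin x c ∷ eqFin c x ∷ E x c ∷ E c x ∷ profile cs x

  Type : Set
  Type = Vec Bool (profileSize (p q))

  type : Fin n → Type
  type = profile ā

  Alike : (Fin n → Fin n → Bool) → Fin n → Fin n → Fin n → Set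
  Alike P u x c = P u c ≡ P x c × P c u ≡ P c x

  profile-alike : ∀ {k} (cs : Vec (Fin n) k) {u x} → profile cs u ≡ profile cs x →
    E u u ≡ E x x × VecAll.All (Alike eqFin u x) cs × VecAll.All (Alike E u x) cs
  profile-alike []       e = ∷-injectiveˡ e , VecAll.[] , VecAll.[]
  profile-alike (c ∷ cs) e =
    let e₁ , e₂ , e₃ , e₄ , e' = ∷⁴-injective e
        loop , eqs , edges     = profile-alike cs e'
    in  loop , (e₁ , e₂) VecAll.∷ eqs , (e₃ , e₄) VecAll.∷ edges

  -- Comparing the environments (cs, u, y) and (cs, x, y) variable by variable:
  -- both hold the same value c, seen alike by u and x, or they hold u and x.
  Twin : (Fin n → Fin n → Bool) → Fin n → Fin n → Fin n → Fin n → Set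
  Twin P u x c c' = (c ≡ c' × Alike P u x c) ⊎ (c ≡ u × c' ≡ x)

  twin-env : ∀ {P u x y k} (cs : Vec (Fin n) k) → VecAll.All (Alike P u x) cs → Alike P u x y →
    ∀ i → Twin P u x (lookup (cs ++ u ∷ y ∷ []) i) (lookup (cs ++ x ∷ y ∷ []) i)
  twin-env []       _                    y-alike zero       = inj₂ (refl , refl)
  twin-env []       _                    y-alike (suc zero) = inj₁ (refl , y-alike)
  twin-env (c ∷ cs) (c-alike VecAll.∷ _) y-alike zero       = inj₁ (refl , c-alike)
  twin-env (c ∷ cs) (_ VecAll.∷ alikes)  y-alike (suc i)    = twin-env cs alikes y-alike i

  twin-pair : ∀ {P u x c c' d d'} → P u u ≡ P x x → Twin P u x c c' → Twin P u x d d' → P c d ≡ P c' d'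
  twin-pair _  (inj₁ (refl , _))      (inj₁ (refl , _))      = refl
  twin-pair _  (inj₁ (refl , _ , cu)) (inj₂ (refl , refl))   = cu
  twin-pair _  (inj₂ (refl , refl))   (inj₁ (refl , uc , _)) = uc
  twin-pair uu (inj₂ (refl , refl))   (inj₂ (refl , refl))   = uu

  Φ-alike : ∀ {u x y} → type u ≡ type x → Alike eqFin u x y → Alike E u x y → Φ u y ≡ Φ x y
  Φ-alike {u} {x} {y} same y-eq y-edge =
    let loop , eqs , edges = profile-alike ā same
        diag = trans (from eqFin-sat (refl {x = u})) (sym (from eqFin-sat (refl {x = x})))
    in  qf-invariant G (φ-qf q) _ _
          (λ i j → twin-pair {eqFin} diag (twin-env ā eqs y-eq i) (twin-env ā eqs y-eq j))
          (λ { tt (i ∷ j ∷ []) → twin-pair {E} loop (twin-env ā edges y-edge i) (twin-env ā edges y-edge j) })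

  unrelated-alike : ∀ {u x y} → eqFin u y ≡ false → eqFin x y ≡ false →
    E u y ≡ false → E x y ≡ false → E y u ≡ false → E y x ≡ false →
    Alike eqFin u x y × Alike E u x y
  unrelated-alike {u} {x} {y} uy xy Euy Exy Eyu Eyx =
    ( trans uy (sym xy)
    , trans (eqFin-sym y u) (trans uy (sym (trans (eqFin-sym y x) xy))) )
    , trans Euy (sym Exy) , trans Eyu (sym Eyx)

  record Fresh (x y : Fin n) : Set where
    field
      inserted : Φ x y ≡ true
      not-old  : E x y ≡ false
      not-back : E y x ≡ false
      distinct : eqFin x y ≡ false

  data Chain : Fin n → Fin n → List Type → Set where
    done : ∀ {u v} → Path G u v → Chain u v []
    hop  : ∀ {u x y v ts} → Path G u x → Fresh x y → Chain y v ts → Chain u v (type x ∷ ts)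

  _◅_ : ∀ {u w v ts} → Path G u w → Chain w v ts → Chain u v ts
  p ◅ done r      = done (p ++ₚ r)
  p ◅ hop r f c   = hop (p ++ₚ r) f c

  _++ᶜ_ : ∀ {u w v ts ts'} → Chain u w ts → Chain w v ts' → Chain u v (ts List.++ ts')
  done p    ++ᶜ c' = p ◅ c'
  hop p f c ++ᶜ c' = hop p f (c ++ᶜ c')

  split : ∀ ts₁ {t ts₂ w v} → Chain w v (ts₁ List.++ t ∷ ts₂) →
    ∃₂ λ x y → Chain w x ts₁ × type x ≡ t × Fresh x y × Chain y v ts₂
  split []        (hop p f c) = _ , _ , done p , refl , f , c
  split (_ ∷ ts₁) (hop p f c) =
    let x , y , c₁ , same , f' , c₂ = split ts₁ c in x , y , hop p f c₁ , same , f' , c₂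

  NormalChain : Fin n → Fin n → Set
  NormalChain u v = ∃ λ ts → Unique ts × Chain u v ts

  ShortCycle : Set
  ShortCycle = ∃₂ λ x y → Edge G⁺ x y × NormalChain y x

  -- Prepending a fresh edge u → w when a later fresh edge xⱼ → yⱼ has the same
  -- source type: unless yⱼ → u closes a cycle, jump from u to yⱼ directly.
  shortcut : ∀ {u w v xⱼ yⱼ} ts₁ ts₂ → Edge G⁺ u w → Unique (ts₁ List.++ type u ∷ ts₂) →
    Chain w xⱼ ts₁ → type xⱼ ≡ type u → Fresh xⱼ yⱼ → Chain yⱼ v ts₂ → NormalChain u v ⊎ ShortCycle
  shortcut {u} {w} {v} {xⱼ} {yⱼ} ts₁ ts₂ uw uniq c₁ same fⱼ c₂
    with unique-suffix ts₁ uniq | eqFin u yⱼ in u≟y | E u yⱼ in uy | E yⱼ u in yu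
  ... | _ ∷ uniq₂ | true  | _     | _     = inj₁ (ts₂ , uniq₂ , ≡⇒Path (to eqFin-sat u≟y) ◅ c₂)
  ... | _ ∷ uniq₂ | false | true  | _     = inj₁ (ts₂ , uniq₂ , edge⇒Path uy ◅ c₂)
  ... | _         | false | false | true  =
    inj₂ (u , w , uw , ts₁ List.++ [ type xⱼ ] , uniq₁ , c₁ ++ᶜ hop here fⱼ (done (edge⇒Path yu)))
    where
    uniq₁ : Unique (ts₁ List.++ [ type xⱼ ])
    uniq₁ = subst (λ t → Unique (ts₁ List.++ [ t ])) (sym same)
              (unique-prefix (ts₁ List.++ [ type u ]) (subst Unique (sym (++-assoc ts₁ [ type u ] ts₂)) uniq))
  ... | uniq₂     | false | false | false = inj₁ (type u ∷ ts₂ , uniq₂ , hop here fresh c₂)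
    where
    open Fresh fⱼ
    fresh : Fresh u yⱼ
    fresh = record
      { inserted = trans (uncurry (Φ-alike (sym same)) (unrelated-alike u≟y distinct uy not-old yu not-back)) inserted
      ; not-old  = uy
      ; not-back = yu
      ; distinct = u≟y }

  consFresh : ∀ {u w v ts} → Edge G⁺ u w → Fresh u w → Unique ts → Chain w v ts → NormalChain u v ⊎ ShortCycle
  consFresh {u} {ts = ts} uw f uniq c with DecMembership._∈?_ (≡-dec Bool._≟_) (type u) ts
  ... | no  new = inj₁ (type u ∷ ts , ¬Any⇒All¬ ts new ∷ uniq , hop here f c)
  ... | yes old with ts₁ , ts₂ , refl ← ∈-∃++ old =
    let xⱼ , yⱼ , c₁ , same , fⱼ , c₂ = split ts₁ c in shortcut ts₁ ts₂ uw uniq c₁ same fⱼ c₂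

  consEdge : ∀ {u w v} → Edge G⁺ u w → NormalChain w v ⊎ ShortCycle → NormalChain u v ⊎ ShortCycle
  consEdge _ (inj₂ cycle) = inj₂ cycle
  consEdge {u} {w} uw (inj₁ (ts , uniq , c)) with E u w in old | E w u in back | eqFin u w in loop
  ... | true  | _     | _     = inj₁ (ts , uniq , edge⇒Path old ◅ c)
  ... | false | true  | _     = inj₂ (u , w , uw , [] , [] , done (edge⇒Path back))
  ... | false | false | true  = inj₂ (u , w , uw , [] , [] , done (≡⇒Path (sym (to eqFin-sat loop))))
  ... | false | false | false = consFresh uw fresh uniq c
    where
    fresh : Fresh u w
    fresh = record
      { inserted = Sum.[ (λ e → contradiction (trans (sym old) e) false≢true) , id ] (to edge⁺-sat uw)
      ; not-old  = old
      ; not-back = back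
      ; distinct = loop }

  normalize : ∀ {u v} → Path G⁺ u v → NormalChain u v ⊎ ShortCycle
  normalize here        = inj₁ ([] , [] , done here)
  normalize (there e p) = consEdge e (normalize p)

  -- Within j u v: G-paths joined by at most j inserted steps (x = y pads the count).
  Within : ℕ → Fin n → Fin n → Set
  Within zero    u v = Path G u v
  Within (suc j) u v = ∃₂ λ x y → Within j u x × (x ≡ y ⊎ Φ x y ≡ true) × Path G y v

  within-extend : ∀ j {u x v} → Within j u x → Path G x v → Within j u v
  within-extend zero    w                     p = w ++ₚ p
  within-extend (suc j) (x , y , w , s , r)   p = x , y , w , s , r ++ₚ p

  within-mono : ∀ {j j' u v} → j ≤ j' → Within j u v → Within j' u v
  within-mono {j' = zero}              z≤n w = w
  within-mono {j' = suc j'} {v = v}    z≤n w = v , v , within-mono {j' = j'} z≤n w , inj₁ refl , here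
  within-mono (s≤s j≤j') (x , y , w , s , r) = x , y , within-mono j≤j' w , s , r

  chain-within : ∀ j {u₀ u v ts} → Within j u₀ u → Chain u v ts → Within (length ts + j) u₀ v
  chain-within j w (done p) = within-extend j w p
  chain-within j {u₀} {v = v} w (hop {x = x} {y} {ts = ts} p f c) =
    subst (λ k → Within k u₀ v) (+-suc (length ts) j)
      (chain-within (suc j) (x , y , within-extend j w p , inj₂ (Fresh.inserted f) , here) c)

  chain⇒within : ∀ {u v ts} → Chain u v ts → Within (length ts) u v
  chain⇒within {u} {v} {ts} c = subst (λ k → Within k u v) (+-identityʳ (length ts)) (chain-within 0 here c)

  within⇒path⁺ : ∀ j {u v} → Within j u v → Path G⁺ u v
  within⇒path⁺ zero    p                            = lift⁺ p
  within⇒path⁺ (suc j) (x , y , w , inj₁ refl , r) = within⇒path⁺ j w ++ₚ lift⁺ r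
  within⇒path⁺ (suc j) (x , y , w , inj₂ xy , r)   =
    within⇒path⁺ j w ++ₚ there (from edge⁺-sat (inj₂ xy)) (lift⁺ r)

  -- A normal chain uses at most one fresh edge per type.
  normal⇒within : ∀ {u v} → NormalChain u v → Within (maxHops (p q)) u v
  normal⇒within (ts , uniq , c) = within-mono (unique-types-bound uniq) (chain⇒within c)

  reach⁺-bounded : Acyclic G⁺ → ∀ {u v} → Path G⁺ u v → Within (maxHops (p q)) u v
  reach⁺-bounded acyclic p with normalize p
  ... | inj₁ nc                 = normal⇒within nc
  ... | inj₂ (x , y , xy , nc) = ⊥-elim (acyclic (x , y , xy , within⇒path⁺ _ (normal⇒within nc)))

  BoundedCycle : Set
  BoundedCycle = ∃₂ λ x y → (Edge G x y ⊎ Φ x y ≡ true) × Within (maxHops (p q)) y x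

  bounded-cycle-sat : BoundedCycle ⇔ HasCycle G⁺
  bounded-cycle-sat = mk⇔ (λ (x , y , xy , w) → x , y , from edge⁺-sat xy , within⇒path⁺ _ w) bounded
    where
    bounded : HasCycle G⁺ → BoundedCycle
    bounded (u , w , uw , p) with normalize p
    ... | inj₁ nc                = u , w , to edge⁺-sat uw , normal⇒within nc
    ... | inj₂ (x , y , xy , nc) = x , y , to edge⁺-sat xy , normal⇒within nc

noAux : Fin 0 → ℕ
noAux ()

StSig : Sig
StSig = stateSig' 0 noAux

inputOf : ∀ {n} → Structure StSig n → Graph n
inputOf st r = st (inj₁ r)

edgeF : ∀ {w} → Fin w → Fin w → Formula StSig w
edgeF u v = rel (inj₁ tt) (u ∷ v ∷ [])

reachF : ∀ {w} → Fin w → Fin w → Formula StSig w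
reachF u v = rel (inj₂ zero) (u ∷ v ∷ []) ∨f (u ≐ v)

RepresentsReach : ∀ {n} → Structure StSig n → Set
RepresentsReach {n} st = ∀ (u v : Fin n) →
  (st (inj₂ zero) (u ∷ v ∷ []) ∨ eqFin u v ≡ true) ⇔ Path (inputOf st) u v

translate : ∀ {v w} {φ : Formula graphSig v} → QF φ → (Fin v → Fin w) → Formula StSig w
translate (qf-rel tt (i ∷ j ∷ [])) f = edgeF (f i) (f j)
translate (qf-eq x y)              f = f x ≐ f y
translate qf-⊤                     f = ⊤f
translate qf-⊥                     f = ⊥f
translate (qf-¬ q)                 f = ¬f translate q f
translate (qf-∧ q r)               f = translate q f ∧f translate r f
translate (qf-∨ q r)               f = translate q f ∨f translate r f

translate-sat : ∀ {n v w} (st : Structure StSig n) {φ : Formula graphSig v} (q : QF φ) (f : Fin v → Fin w) ρ →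
  eval st (translate q f) ρ ≡ eval (inputOf st) φ (ρ ∘ f)
translate-sat st (qf-rel tt (i ∷ j ∷ [])) f ρ = refl
translate-sat st (qf-eq x y)              f ρ = refl
translate-sat st qf-⊤                     f ρ = refl
translate-sat st qf-⊥                     f ρ = refl
translate-sat st (qf-¬ q)                 f ρ = cong not (translate-sat st q f ρ)
translate-sat st (qf-∧ q r)               f ρ = cong₂ _∧_ (translate-sat st q f ρ) (translate-sat st r f ρ)
translate-sat st (qf-∨ q r)               f ρ = cong₂ _∨_ (translate-sat st q f ρ) (translate-sat st r f ρ)

weaken₂ : ∀ {w} → Fin w → Fin (suc (suc w))
weaken₂ i = suc (suc i)

module InsertionFormulas (q : InsertionQuery) where

  insertedF : ∀ {w} → Vec (Fin w) (p q) → Fin w → Fin w → Formula StSig w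
  insertedF pv x y = translate (φ-qf q) (lookup (pv ++ x ∷ y ∷ []))

  withinF : ℕ → ∀ {w} → Vec (Fin w) (p q) → Fin w → Fin w → Formula StSig w
  withinF zero    pv u v = reachF u v
  withinF (suc j) pv u v =
    ∃f (∃f (withinF j pv₂ (weaken₂ u) x ∧f (((x ≐ y) ∨f insertedF pv₂ x y) ∧f reachF y (weaken₂ v))))
    where
    x y : Fin _
    x = suc zero
    y = zero
    pv₂ : Vec (Fin _) (p q)
    pv₂ = Vec.map weaken₂ pv

  insertUpdate : Formula StSig (p q + 2)
  insertUpdate = withinF (maxHops (p q)) (tabulate (_↑ˡ 2)) (p q ↑ʳ zero) (p q ↑ʳ suc zero)

  insertGuard : Formula StSig (p q)
  insertGuard = ∃f (∃f ((edgeF x y ∨f insertedF pv₂ x y) ∧f withinF (maxHops (p q)) pv₂ y x))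
    where
    x y : Fin _
    x = suc zero
    y = zero
    pv₂ : Vec (Fin _) (p q)
    pv₂ = tabulate weaken₂

  module Semantics {n} (st : Structure StSig n) (reach : RepresentsReach st) (ā : Vec (Fin n) (p q)) where
    open Insertion q (inputOf st) ā

    insertedF-sat : ∀ {w} (pv : Vec (Fin w) (p q)) x y (ρ : Fin w → Fin n) → Vec.map ρ pv ≡ ā →
      eval st (insertedF pv x y) ρ ≡ Φ (ρ x) (ρ y)
    insertedF-sat pv x y ρ pv↦ā =
      trans (translate-sat st (φ-qf q) _ ρ) (qf-cong (inputOf st) (φ-qf q) pointwise)
      where
      pointwise : ∀ i → ρ (lookup (pv ++ x ∷ y ∷ []) i) ≡ lookup (ā ++ ρ x ∷ ρ y ∷ []) i
      pointwise i = begin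
        ρ (lookup (pv ++ x ∷ y ∷ []) i)               ≡⟨ lookup-map i ρ (pv ++ x ∷ y ∷ []) ⟨
        lookup (Vec.map ρ (pv ++ x ∷ y ∷ [])) i       ≡⟨ cong (λ vs → lookup vs i) (map-++ ρ pv (x ∷ y ∷ [])) ⟩
        lookup (Vec.map ρ pv ++ ρ x ∷ ρ y ∷ []) i     ≡⟨ cong (λ vs → lookup (vs ++ ρ x ∷ ρ y ∷ []) i) pv↦ā ⟩
        lookup (ā ++ ρ x ∷ ρ y ∷ []) i                ∎
        where open ≡-Reasoning

    withinF-sat : ∀ j {w} (pv : Vec (Fin w) (p q)) u v (ρ : Fin w → Fin n) → Vec.map ρ pv ≡ ā →
      (eval st (withinF j pv u v) ρ ≡ true) ⇔ Within j (ρ u) (ρ v)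
    withinF-sat zero    pv u v ρ _     = reach (ρ u) (ρ v)
    withinF-sat (suc j) pv u v ρ pv↦ā =
      ∃-sat λ a → ∃-sat λ b →
        let ρ₂    = b ▸ (a ▸ ρ)
            pv₂↦ā = trans (sym (map-∘ ρ₂ weaken₂ pv)) pv↦ā
        in ∧-sat (withinF-sat j (Vec.map weaken₂ pv) (weaken₂ u) (suc zero) ρ₂ pv₂↦ā)
             (∧-sat (∨-sat eqFin-sat (≡-sat (insertedF-sat (Vec.map weaken₂ pv) (suc zero) zero ρ₂ pv₂↦ā)))
                    (reach b (ρ v)))

    insertUpdate-sat : Acyclic G⁺ → ∀ u v →
      (eval st insertUpdate (env ā (u ∷ v ∷ [])) ≡ true) ⇔ Path G⁺ u v
    insertUpdate-sat acyclic u v =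
      mk⇔ (within⇒path⁺ _ ∘ subst₂ (Within _) (env-fst ā u v) (env-snd ā u v) ∘ to W)
          (from W ∘ subst₂ (Within _) (sym (env-fst ā u v)) (sym (env-snd ā u v)) ∘ reach⁺-bounded acyclic)
      where
      W : (eval st insertUpdate (env ā (u ∷ v ∷ [])) ≡ true)
          ⇔ Within (maxHops (p q)) (env ā (u ∷ v ∷ []) (p q ↑ʳ zero)) (env ā (u ∷ v ∷ []) (p q ↑ʳ suc zero))
      W = withinF-sat (maxHops (p q)) (tabulate (_↑ˡ 2)) (p q ↑ʳ zero) (p q ↑ʳ suc zero) (env ā (u ∷ v ∷ []))
            (map-tabulate-lookup ā _ _ (lookup-++ˡ ā (u ∷ v ∷ [])))

    insertGuard-sat : (eval st insertGuard (λ i → lookup ā i) ≡ true) ⇔ HasCycle G⁺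
    insertGuard-sat =
      bounded-cycle-sat ⇔-∘
      (∃-sat λ a → ∃-sat λ b →
        let ρ₂    = b ▸ (a ▸ lookup ā)
            pv₂↦ā = map-tabulate-lookup ā weaken₂ ρ₂ (λ _ → refl)
        in ∧-sat (∨-sat (mk⇔ id id) (≡-sat (insertedF-sat (tabulate weaken₂) (suc zero) zero ρ₂ pv₂↦ā)))
                 (withinF-sat (maxHops (p q)) (tabulate weaken₂) zero (suc zero) ρ₂ pv₂↦ā))

-- The update of Q after deleting the edge a → b; variables 0, 1 hold a, b and
-- variables 2, 3 the tuple x, y.
deleteUpdate : Formula StSig 4
deleteUpdate =
  reachF x y ∧f ((¬f edgeF a b) ∨f ((¬f (reachF x a ∧f reachF b y)) ∨f ∃f (∃f exit)))
  where
  a b x y : Fin 4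
  a = zero
  b = suc zero
  x = suc (suc zero)
  y = suc (suc (suc zero))
  exit : Formula StSig 6
  exit =
    let u = suc zero ; v = zero in
    (reachF (weaken₂ x) u ∧f (edgeF u v ∧f (¬f ((u ≐ weaken₂ a) ∧f (v ≐ weaken₂ b)))))
    ∧f (reachF v (weaken₂ y) ∧f (reachF u (weaken₂ a) ∧f (¬f reachF v (weaken₂ a))))

module Deletion {n} (st : Structure StSig n) (reach : RepresentsReach st)
                (acyclic : Acyclic (inputOf st)) (a b : Fin n) where

  G : Graph n
  G = inputOf st

  G⁻ : Graph n
  G⁻ = applyChange deleteE (a ∷ b ∷ []) G

  remaining-sat : ∀ {u v} → Edge G⁻ u v ⇔ (Edge G u v × ¬ (u ≡ a × v ≡ b))
  remaining-sat = ∧-sat (mk⇔ id id) (not-sat (∧-sat eqFin-sat eqFin-sat))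

  forget : ∀ {u v} → Path G⁻ u v → Path G u v
  forget = mapPath (proj₁ ∘ to remaining-sat)

  -- Old reachability is decidable, being represented by Q.
  path? : ∀ u v → Dec (Path G u v)
  path? u v with st (inj₂ zero) (u ∷ v ∷ []) ∨ eqFin u v in e
  ... | true  = yes (to (reach u v) e)
  ... | false = no (λ p → false≢true (trans (sym e) (from (reach u v) p)))

  avoid : ∀ {x y} → Path G x y → Path G⁻ x y ⊎ (Edge G a b × Path G x a × Path G b y)
  avoid here = inj₁ here
  avoid {x} (there {w = w} xw p) with (x ≟ a) ×-dec (w ≟ b)
  ... | yes (refl , refl) = inj₂ (xw , here , p)
  ... | no not-ab with avoid p
  ...   | inj₁ p⁻              = inj₁ (there (from remaining-sat (xw , not-ab)) p⁻)
  ...   | inj₂ (ab , wa , by) = inj₂ (ab , there xw wa , by)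

  Exit : Fin n → Fin n → Set
  Exit x y = ∃₂ λ u v → (Path G x u × Edge G⁻ u v) × (Path G v y × (Path G u a × ¬ Path G v a))

  leave : ∀ {x y} → Path G⁻ x y → Path G x a → ¬ Path G y a → Exit x y
  leave here xa ¬ya = contradiction xa ¬ya
  leave {x} (there {w = w} xw p) xa ¬ya with path? w a
  ... | yes wa =
    let u , v , (wu , uv) , rest = leave p wa ¬ya
    in  u , v , (there (proj₁ (to remaining-sat xw)) wu , uv) , rest
  ... | no ¬wa = x , w , (here , xw) , (forget p , xa , ¬wa)

  Survives : Fin n → Fin n → Set
  Survives x y = Path G x y × (¬ Edge G a b ⊎ (¬ (Path G x a × Path G b y) ⊎ Exit x y))

  -- Soundness: the two subpaths around the exit cannot use a → b, as that
  -- would close a cycle or make v reach a.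
  survives⇒path : ∀ {x y} → Survives x y → Path G⁻ x y
  survives⇒path (p , inj₁ no-ab) with avoid p
  ... | inj₁ p⁻      = p⁻
  ... | inj₂ (ab , _) = contradiction ab no-ab
  survives⇒path (p , inj₂ (inj₁ not-through)) with avoid p
  ... | inj₁ p⁻             = p⁻
  ... | inj₂ (_ , through) = contradiction through not-through
  survives⇒path (_ , inj₂ (inj₂ (u , v , (xu , uv) , (vy , ua , ¬va)))) with avoid xu | avoid vy
  ... | inj₁ xu⁻             | inj₁ vy⁻          = xu⁻ ++ₚ there uv vy⁻
  ... | inj₂ (ab , _ , bu)   | _                 = ⊥-elim (acyclic (a , b , ab , bu ++ₚ ua))
  ... | inj₁ _               | inj₂ (_ , va , _) = contradiction va ¬va

  -- Completeness: if x ⇝ a and b ⇝ y in G, then y does not reach a (acyclicity),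
  -- so the G⁻-path has an exit.
  path⇒survives : ∀ {x y} → Path G⁻ x y → Survives x y
  path⇒survives {x} {y} p with G tt (a ∷ b ∷ []) in ab
  ... | false = forget p , inj₁ (λ ())
  ... | true with path? x a | path? b y
  ...   | yes xa | yes by = forget p , inj₂ (inj₂ (leave p xa (λ ya → acyclic (a , b , ab , by ++ₚ ya))))
  ...   | no ¬xa | _      = forget p , inj₂ (inj₁ (¬xa ∘ proj₁))
  ...   | yes _  | no ¬by = forget p , inj₂ (inj₁ (¬by ∘ proj₂))

  deleteUpdate-sat : ∀ x y → (eval st deleteUpdate (env (a ∷ b ∷ []) (x ∷ y ∷ [])) ≡ true) ⇔ Path G⁻ x y
  deleteUpdate-sat x y = mk⇔ survives⇒path path⇒survives ⇔-∘ meaning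
    where
    meaning : (eval st deleteUpdate (env (a ∷ b ∷ []) (x ∷ y ∷ [])) ≡ true) ⇔ Survives x y
    meaning =
      ∧-sat (reach x y)
        (∨-sat (not-sat (mk⇔ id id))
          (∨-sat (not-sat (∧-sat (reach x a) (reach b y)))
            (∃-sat λ u → ∃-sat λ v →
              ∧-sat (∧-sat (reach x u) (mk⇔ id id))
                    (∧-sat (reach v y) (∧-sat (reach u a) (not-sat (reach v a)))))))

-- The single-edge insertion of Δ_E is
-- the quantifier-free insertion query with Φ(p̄, x̄) = (x̄ = p̄).
edgeInsertion : InsertionQuery
edgeInsertion = record
  { p    = 2
  ; φ    = (suc (suc zero) ≐ zero) ∧f (suc (suc (suc zero)) ≐ suc zero)
  ; φ-qf = qf-∧ (qf-eq _ _) (qf-eq _ _) }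

open InsertionFormulas using (insertUpdate; insertGuard)
open InsertionFormulas.Semantics using (insertUpdate-sat; insertGuard-sat)

updates : (Δ : List InsertionQuery) (i : Fin (length (allowed Δ))) →
  Formula StSig (params (List.lookup (allowed Δ) i) + 2)
updates []      zero       = insertUpdate edgeInsertion
updates []      (suc zero) = deleteUpdate
updates (q ∷ Δ) zero       = insertUpdate q
updates (q ∷ Δ) (suc i)    = updates Δ i

reachProgram : (Δ : List InsertionQuery) → Program (allowed Δ)
reachProgram Δ = record { k = 0 ; arities = noAux ; update = λ { i zero → updates Δ i } }

update-sat : ∀ Δ i {n} (ā : Vec (Fin n) (params (List.lookup (allowed Δ) i))) (st : Structure StSig n) →
  RepresentsReach st → Acyclic (inputOf st) →
  Acyclic (applyChange (List.lookup (allowed Δ) i) ā (inputOf st)) → ∀ u v →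
  (eval st (updates Δ i) (env ā (u ∷ v ∷ [])) ≡ true)
    ⇔ Path (applyChange (List.lookup (allowed Δ) i) ā (inputOf st)) u v
update-sat []      zero       ā            st reach _       acyclic⁺ =
  insertUpdate-sat edgeInsertion st reach ā acyclic⁺
update-sat []      (suc zero) (a ∷ b ∷ []) st reach acyclic _        =
  Deletion.deleteUpdate-sat st reach acyclic a b
update-sat (q ∷ Δ) zero       ā            st reach _       acyclic⁺ =
  insertUpdate-sat q st reach ā acyclic⁺
update-sat (q ∷ Δ) (suc i) = update-sat Δ i

module Run (Δ : List InsertionQuery) where

  P : Program (allowed Δ)
  P = reachProgram Δ

  -- Q represents reachability up to the diagonal; after a change it is exact.
  Invariant : ∀ {n} → State P n → Set
  Invariant s = RepresentsReach (asStructure s)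

  Correct : ∀ {n} → State P n → Set
  Correct {n} s = ∀ (u v : Fin n) → (aux s zero (u ∷ v ∷ []) ≡ true) ⇔ Path (input s) u v

  correct⇒invariant : ∀ {n} {s : State P n} → Correct s → Invariant s
  correct⇒invariant {s = s} correct u v = mk⇔ (Sum.[ id , ≡⇒Path ] ∘ to Q-or-eq) (from Q-or-eq ∘ inj₁)
    where
    Q-or-eq : (aux s zero (u ∷ v ∷ []) ∨ eqFin u v ≡ true) ⇔ (Path (input s) u v ⊎ u ≡ v)
    Q-or-eq = ∨-sat (correct u v) eqFin-sat

  initial-invariant : ∀ n → Invariant (initState P n)
  initial-invariant n u v = mk⇔ (≡⇒Path ∘ to eqFin-sat) λ { here → from eqFin-sat (refl {x = u}) ; (there () _) }

  initial-acyclic : ∀ n → Acyclic (input (initState P n))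
  initial-acyclic n (_ , _ , () , _)

  step-correct : ∀ {n} (s : State P n) c → Invariant s → Acyclic (input s) →
    Acyclic (input (step P s c)) → Correct (step P s c)
  step-correct s (i , ā) = update-sat Δ i ā (asStructure s)

  next-invariant : ∀ {n} (s : State P n) c → Invariant s → Acyclic (input s) →
    Acyclic (input (step P s c)) → Invariant (step P s c)
  next-invariant s c inv acyclic acyclic' = correct⇒invariant {s = step P s c} (step-correct s c inv acyclic acyclic')

  invariant-along : ∀ {n} (s : State P n) cs → Invariant s → Acyclic (input s) →
    All (λ s → Acyclic (input s)) (trace P s cs) → Invariant (foldl (step P) s cs)
  invariant-along s []       inv _       _                = inv
  invariant-along s (c ∷ cs) inv acyclic (acyclic' ∷ rest) =
    invariant-along (step P s c) cs (next-invariant s c inv acyclic acyclic') acyclic' rest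

  correct-along : ∀ {n} (s : State P n) c cs → Invariant s → Acyclic (input s) →
    All (λ s → Acyclic (input s)) (trace P s (c ∷ cs)) → Correct (foldl (step P) s (c ∷ cs))
  correct-along s c []        inv acyclic (acyclic' ∷ _)    = step-correct s c inv acyclic acyclic'
  correct-along s c (c' ∷ cs) inv acyclic (acyclic' ∷ rest) =
    correct-along (step P s c) c' cs (next-invariant s c inv acyclic acyclic') acyclic' rest

  maintains : MaintainsReachDAG P
  maintains n []       nonempty _     = contradiction refl nonempty
  maintains n (c ∷ cs) _        valid =
    correct-along (initState P n) c cs (initial-invariant n) (initial-acyclic n) valid

  guards : ∀ q → IsGuard P q (insertGuard q)
  guards q n cs valid ā =
    insertGuard-sat q (asStructure (run P cs))
      (invariant-along (initState P n) cs (initial-invariant n) (initial-acyclic n) valid) ā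

theorem5 : (Δ : List InsertionQuery) →
  ∃ λ (P : Program (allowed Δ)) →
    MaintainsReachDAG P ×
    ((j : Fin (length Δ)) →
      ∃ λ (γ : Formula (stateSig P) (p (List.lookup Δ j))) → IsGuard P (List.lookup Δ j) γ)
theorem5 Δ = P , maintains , λ j → insertGuard (List.lookup Δ j) , guards (List.lookup Δ j)
  where open Run Δ
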